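{- Let $c$ be a stable configuration on $K_{m,n}$ for which some nonempty $A\subseteq\{v_1,\dots,v_{n+m-1}\}$ makes $c-\Delta_A$ stable, and let $A$ be the $\prec$-minimal such nonempty set. Let $v_i,v_j$ be two vertices in the same component (both in $\{v_1,\dots,v_n\}$ or both in $\{v_{n+1},\dots,v_{n+m-1}\}$). If $c_i\ge c_j$ and $v_j\in A$, then $v_i\in A$.
   Context: $K_{m,n}$ has vertices $v_1,\dots,v_{n+m}$, a single edge between $v_i,v_j$ exactly when $i\le n<j$, sink $v_{n+m}$. Configurations are $c\in\mathbb{Z}^{n+m-1}$. $\Delta_i$ is the toppling vector of $v_i$: for $i\le n$, entry $m$ at $i$ and $-1$ at $n+1,\dots,n+m-1$; for $n<i<n+m$, entry $n$ at $i$ and $-1$ at $1,\dots,n$; $\Delta_A=\sum_{v_i\in A}\Delta_i$. $c$ is stable if $0\le c_i\le m-1$ for $i\le n$ and $0\le c_i\le n-1$ for $n<i<n+m$. Subsets are ordered by $A\prec B$ if $|A|<|B|$, or $|A|=|B|$ and $A$ is lexicographically smaller (increasing index listing). -}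

module Defs where

open import Data.Nat as ℕ using (ℕ; zero; suc)
open import Data.Integer as ℤ using (ℤ; +_; -[1+_]; _-_)
open import Data.Fin using (Fin; toℕ)
open import Data.Fin.Subset using (Subset; _∈_; Nonempty; ∣_∣)
open import Data.Vec using (lookup)
open import Data.Bool using (Bool; true; false; if_then_else_)
open import Data.List using (List; []; _∷_; sum; map; filter; allFin)
open import Data.Product using (_×_)
open import Data.Sum using (_⊎_)
open import Relation.Binary.PropositionalEquality using (_≡_)
open import Relation.Nullary.Decidable using (does)

-- K_{m,n} with n = suc n' (left part v_1..v_n) and m = suc k
-- (right part v_{n+1}..v_{n+m-1} plus the sink v_{n+m}).
-- Non-sink vertices are Fin (n + k); vertex v_{i} corresponds to the
-- element with toℕ = i - 1 (so index order is preserved).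

NS : ℕ → ℕ → ℕ
NS n k = n ℕ.+ k

isLeft : (n k : ℕ) → Fin (NS n k) → Bool
isLeft n k v = does (toℕ v ℕ.<? n)

Config : ℕ → ℕ → Set
Config n k = Fin (NS n k) → ℤ

Δ : (n k : ℕ) → Fin (NS n k) → Fin (NS n k) → ℤ
Δ n k u v with isLeft n k u | isLeft n k v | does (toℕ u ℕ.≟ toℕ v)
... | true  | true  | true  = + (suc k)
... | true  | true  | false = + 0
... | true  | false | _     = -[1+ 0 ]
... | false | false | true  = + n
... | false | false | false = + 0
... | false | true  | _     = -[1+ 0 ]

ΔSet : (n k : ℕ) → Subset (NS n k) → Fin (NS n k) → ℤ
ΔSet n k A v =
  Data.List.foldr ℤ._+_ (+ 0)
    (map (λ u → if lookup A u then Δ n k u v else + 0) (allFin (NS n k)))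

topple : (n k : ℕ) → Config n k → Subset (NS n k) → Config n k
topple n k c A v = c v - ΔSet n k A v

Stable : (n k : ℕ) → Config n k → Set
Stable n k c = (v : Fin (NS n k)) →
  (+ 0 ℤ.≤ c v) × (if isLeft n k v then c v ℤ.≤ + k else c v ℤ.< + n)

members : {N : ℕ} → Subset N → List ℕ
members {N} A = map toℕ (filter (λ u → lookup A u Data.Bool.≟ true) (allFin N))

data LexLt : List ℕ → List ℕ → Set where
  lex-[] : ∀ {y ys} → LexLt [] (y ∷ ys)
  lex-<  : ∀ {x y xs ys} → x ℕ.< y → LexLt (x ∷ xs) (y ∷ ys)
  lex-≡  : ∀ {x xs ys} → LexLt xs ys → LexLt (x ∷ xs) (x ∷ ys)

_≺_ : {N : ℕ} → Subset N → Subset N → Set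
A ≺ B = (∣ A ∣ ℕ.< ∣ B ∣) ⊎ ((∣ A ∣ ≡ ∣ B ∣) × LexLt (members A) (members B))

MinimalToppleSet : (n k : ℕ) → Config n k → Subset (NS n k) → Set
MinimalToppleSet n k c A =
  Nonempty A × Stable n k (topple n k c A) ×
  ((B : Subset (NS n k)) → Nonempty B → Stable n k (topple n k c B) → B ≺ A → Data.Empty.⊥)
  where import Data.Empty

-- If v_j ∈ A and v_i ∉ A lie on the same side, every u ∈ A contributes to (Δ_A)_i
-- at most what it contributes to (Δ_A)_j, and v_j itself contributes its degree
-- deg (= m or n) to (Δ_A)_j but 0 to (Δ_A)_i; so (Δ_A)_j ≥ deg + (Δ_A)_i.
-- Stability of c - Δ_A then gives c_i < deg + (Δ_A)_i ≤ (Δ_A)_j ≤ c_j, contradicting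
-- c_i ≥ c_j.
module Submission where

open import Defs
open import Data.Nat using (ℕ; suc)
open import Data.Integer using (_≥_)
open import Data.Fin using (Fin)
open import Data.Fin.Subset using (Subset; _∈_)
open import Relation.Binary.PropositionalEquality using (_≡_)

import Data.Nat as ℕ
import Data.Nat.Properties as ℕP
open import Data.Integer using (ℤ; +_; _+_; _-_; _≤_; _<_; +≤+; +<+)
import Data.Integer.Properties as ℤP
open import Data.Fin using (toℕ)
open import Data.Fin.Properties using (toℕ-injective)
open import Data.Vec using (lookup)
open import Data.Vec.Properties using (lookup⇒[]=; []=⇒lookup)
open import Data.Bool using (Bool; true; false; if_then_else_)
open import Data.List using (List; []; _∷_; map; foldr; allFin)
open import Data.List.Relation.Unary.Any using (here; there)
open import Data.List.Membership.Propositional using () renaming (_∈_ to _∈ₗ_)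
open import Data.List.Membership.Propositional.Properties using (∈-allFin)
open import Data.Product using (_,_; proj₁; proj₂)
open import Data.Empty using (⊥-elim)
open import Function using (_∘_)
open import Relation.Nullary.Decidable using (does; dec-true; dec-false)
open import Relation.Binary.PropositionalEquality using (_≢_; refl; sym; trans; cong)
open import Algebra.Bundles using (AbelianGroup)
open import Algebra.Properties.Group (AbelianGroup.group ℤP.+-0-abelianGroup)
  using (//-rightDividesˡ)
open import Algebra.Properties.CommutativeSemigroup ℤP.+-commutativeSemigroup
  using (x∙yz≈y∙xz)

∑ : ∀ {a} {X : Set a} → (X → ℤ) → List X → ℤ
∑ f xs = foldr _+_ (+ 0) (map f xs)

∑-mono-≤ : ∀ {a} {X : Set a} (f g : X → ℤ) → (∀ x → f x ≤ g x) →
           (xs : List X) → ∑ f xs ≤ ∑ g xs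
∑-mono-≤ f g f≤g []       = ℤP.≤-refl
∑-mono-≤ f g f≤g (x ∷ xs) = ℤP.+-mono-≤ (f≤g x) (∑-mono-≤ f g f≤g xs)

∑-mono-≤-gap : ∀ {a} {X : Set a} (f g : X → ℤ) (d : ℤ) {y : X} →
               (∀ x → f x ≤ g x) → d + f y ≤ g y →
               (xs : List X) → y ∈ₗ xs → d + ∑ f xs ≤ ∑ g xs
∑-mono-≤-gap f g d f≤g gap (x ∷ xs) (here refl) =
  ℤP.≤-trans (ℤP.≤-reflexive (sym (ℤP.+-assoc d (f x) _)))
             (ℤP.+-mono-≤ gap (∑-mono-≤ f g f≤g xs))
∑-mono-≤-gap f g d f≤g gap (x ∷ xs) (there y∈xs) =
  ℤP.≤-trans (ℤP.≤-reflexive (x∙yz≈y∙xz d (f x) _))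
             (ℤP.+-mono-≤ (f≤g x) (∑-mono-≤-gap f g d f≤g gap xs y∈xs))

module _ (n k : ℕ) where

  degree : Bool → ℤ
  degree true  = + suc k
  degree false = + n

  Δ-self : ∀ u → Δ n k u u ≡ degree (isLeft n k u)
  Δ-self u rewrite dec-true (toℕ u ℕ.≟ toℕ u) refl with isLeft n k u
  ... | true  = refl
  ... | false = refl

  private
    toℕ-≢ : {u v : Fin (NS n k)} → u ≢ v → does (toℕ u ℕ.≟ toℕ v) ≡ false
    toℕ-≢ {u} {v} u≢v = dec-false (toℕ u ℕ.≟ toℕ v) (u≢v ∘ toℕ-injective)

  Δ-sameSide : ∀ u v → isLeft n k v ≡ isLeft n k u → u ≢ v → Δ n k u v ≡ + 0
  Δ-sameSide u v side u≢v = go side (toℕ-≢ u≢v)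
    where
    go : isLeft n k v ≡ isLeft n k u → does (toℕ u ℕ.≟ toℕ v) ≡ false → Δ n k u v ≡ + 0
    go _ _ with isLeft n k u | isLeft n k v | does (toℕ u ℕ.≟ toℕ v)
    go refl refl | true  | .true  | .false = refl
    go refl refl | false | .false | .false = refl

  Δ-mono-sameSide : ∀ u v v' → isLeft n k v ≡ isLeft n k v' → u ≢ v →
                    Δ n k u v ≤ Δ n k u v'
  Δ-mono-sameSide u v v' side u≢v = go side (toℕ-≢ u≢v)
    where
    go : isLeft n k v ≡ isLeft n k v' → does (toℕ u ℕ.≟ toℕ v) ≡ false →
         Δ n k u v ≤ Δ n k u v'
    go _ _ with isLeft n k u | isLeft n k v | isLeft n k v'
                   | does (toℕ u ℕ.≟ toℕ v) | does (toℕ u ℕ.≟ toℕ v')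
    go refl refl | true  | true  | .true  | .false | true  = +≤+ ℕ.z≤n
    go refl refl | true  | true  | .true  | .false | false = ℤP.≤-refl
    go refl refl | true  | false | .false | .false | _     = ℤP.≤-refl
    go refl refl | false | false | .false | .false | true  = +≤+ ℕ.z≤n
    go refl refl | false | false | .false | .false | false = ℤP.≤-refl
    go refl refl | false | true  | .true  | .false | _     = ℤP.≤-refl

  ΔSet-gap : (A : Subset (NS n k)) (i j : Fin (NS n k)) →
             isLeft n k i ≡ isLeft n k j → lookup A i ≡ false → lookup A j ≡ true →
             degree (isLeft n k j) + ΔSet n k A i ≤ ΔSet n k A j
  ΔSet-gap A i j side i∉A j∈A =
    ∑-mono-≤-gap (term i) (term j) (degree (isLeft n k j)) term-mono term-gap (allFin _) (∈-allFin j)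
    where
    term : Fin (NS n k) → Fin (NS n k) → ℤ
    term v u = if lookup A u then Δ n k u v else + 0

    ≢i : ∀ {u} → lookup A u ≡ true → u ≢ i
    ≢i u∈A refl with () ← trans (sym u∈A) i∉A

    term-mono : ∀ u → term i u ≤ term j u
    term-mono u with lookup A u in u∈?A
    ... | true  = Δ-mono-sameSide u i j side (≢i u∈?A)
    ... | false = ℤP.≤-refl

    term-gap : degree (isLeft n k j) + term i j ≤ term j j
    term-gap rewrite j∈A | Δ-sameSide j i side (≢i j∈A) | Δ-self j =
      ℤP.≤-reflexive (ℤP.+-identityʳ _)

  stable⇒<degree : ∀ {d} → Stable n k d → ∀ v → d v < degree (isLeft n k v)
  stable⇒<degree st v with isLeft n k v | proj₂ (st v)
  ... | true  | dv≤k = ℤP.≤-<-trans dv≤k (+<+ (ℕP.n<1+n k))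
  ... | false | dv<n = dv<n

lemma4p3 : (n' k : ℕ) → let n = suc n' in
    (c : Config n k) → Stable n k c →
    (A : Subset (NS n k)) → MinimalToppleSet n k c A →
    (i j : Fin (NS n k)) → isLeft n k i ≡ isLeft n k j →
    c i ≥ c j → j ∈ A → i ∈ A
lemma4p3 n' k c _ A (_ , stable-c-ΔA , _) i j side cj≤ci j∈A with lookup A i in i∈?A
... | true  = lookup⇒[]= i A i∈?A
... | false = ⊥-elim (ℤP.<-irrefl refl (begin-strict
  c j                                ≤⟨ cj≤ci ⟩
  c i                                ≡⟨ //-rightDividesˡ (ΔA i) (c i) ⟨
  c i - ΔA i + ΔA i                  <⟨ ℤP.+-monoˡ-< (ΔA i) (stable⇒<degree n k stable-c-ΔA i) ⟩
  degree n k (isLeft n k i) + ΔA i   ≡⟨ cong (λ b → degree n k b + ΔA i) side ⟩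
  degree n k (isLeft n k j) + ΔA i   ≤⟨ ΔSet-gap n k A i j side i∈?A ([]=⇒lookup j∈A) ⟩
  ΔA j                               ≤⟨ ℤP.0≤i-j⇒j≤i (proj₁ (stable-c-ΔA j)) ⟩
  c j                                ∎))
  where
  open ℤP.≤-Reasoning
  n : ℕ
  n = suc n'
  ΔA : Fin (NS n k) → ℤ
  ΔA = ΔSet n k A
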